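{- For every integer $m\ge1$, $$\sum_{k\ge1}\frac{\prod_{i=1}^{m}q^{2k+2i}}{\prod_{i=0}^{m}(1+q^{2k+2i+1})}=\frac{q^{2m}}{1-q^{2m}}\cdot\frac{\prod_{i=1}^{m}q^{2i}}{\prod_{i=1}^{m}(1+q^{2i+1})}.$$
   Context: The identity is understood as an identity of formal power series in $q$ (equivalently, of analytic functions for $|q|<1$). -}

module Defs where

open import Data.Nat using (ℕ; zero; suc; _∸_; _≤_)
import Data.Nat as ℕ
open import Data.Integer as ℤ using (ℤ; +_; -_)
open import Data.List using (List; []; _∷_; map; foldr; upTo; zipWith)
open import Data.Product using (∃)
open import Relation.Binary.PropositionalEquality using (_≡_)
open import Relation.Nullary using (yes; no)

sumℤ : List ℤ → ℤ
sumℤ = foldr ℤ._+_ (+ 0)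

-- Formal power series in q with integer coefficients: n ↦ coefficient of q^n.
FPS : Set
FPS = ℕ → ℤ

_≈ₛ_ : FPS → FPS → Set
f ≈ₛ g = ∀ n → f n ≡ g n

infixl 6 _⊕_ _⊖_
infixl 7 _⊗_

𝟙 : FPS
𝟙 zero    = + 1
𝟙 (suc _) = + 0

q^ : ℕ → FPS
q^ a n with n ℕ.≟ a
... | yes _ = + 1
... | no  _ = + 0

_⊕_ : FPS → FPS → FPS
(f ⊕ g) n = f n ℤ.+ g n

_⊖_ : FPS → FPS → FPS
(f ⊖ g) n = f n ℤ.- g n

_⊗_ : FPS → FPS → FPS
(f ⊗ g) n = sumℤ (map (λ j → f j ℤ.* g (n ∸ j)) (upTo (suc n)))

Σ< : ℕ → (ℕ → FPS) → FPS
Σ< zero    F = λ _ → + 0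
Σ< (suc n) F = Σ< n F ⊕ F n

Π< : ℕ → (ℕ → FPS) → FPS
Π< zero    F = 𝟙
Π< (suc n) F = Π< n F ⊗ F n

-- Multiplicative inverse of a power series with constant term 1.
-- invList f n = [b_n , b_{n-1} , … , b_0] where b_0 = 1 and
-- b_n = - Σ_{j=1}^{n} f_j b_{n-j}   (so that f · b = 1 when f_0 = 1).
invList : FPS → ℕ → List ℤ
invList f zero    = + 1 ∷ []
invList f (suc n) =
  (- sumℤ (zipWith ℤ._*_ (map (λ j → f (suc j)) (upTo (suc n))) (invList f n)))
  ∷ invList f n

inv : FPS → FPS
inv f n with invList f n
... | []    = + 0
... | b ∷ _ = b

-- Quotient f / g for g with constant term 1.
_⊘_ : FPS → FPS → FPS
f ⊘ g = f ⊗ inv g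

-- q-adic (formal) convergence: Σ_{k≥1} F k = S, i.e. for every n the
-- coefficient of q^n in the partial sums Σ_{k=1}^{K} F k is eventually S n.
HasSum₁ : (ℕ → FPS) → FPS → Set
HasSum₁ F S = ∀ n → ∃ λ N → ∀ K → N ≤ K → Σ< K (λ i → F (suc i)) n ≡ S n

term : ℕ → ℕ → FPS
term m k = Π< m (λ i → q^ (2 ℕ.* k ℕ.+ 2 ℕ.* suc i))
         ⊘ Π< (suc m) (λ i → 𝟙 ⊕ q^ (2 ℕ.* k ℕ.+ 2 ℕ.* i ℕ.+ 1))

rhs : ℕ → FPS
rhs m = (q^ (2 ℕ.* m) ⊘ (𝟙 ⊖ q^ (2 ℕ.* m)))
      ⊗ (Π< m (λ i → q^ (2 ℕ.* suc i))
         ⊘ Π< m (λ i → 𝟙 ⊕ q^ (2 ℕ.* suc i ℕ.+ 1)))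

{-# OPTIONS --safe #-}
module Submission where

-- With P k = Π_{i<m} (1 + q^{2k+2i+1}), c = Π_{i=1}^{m} q^{2i}, E = 1 - q^{2m} and
-- G k = q^{2km} / P k, the k-th summand is T k - T (k+1) where T k = c G k / E: its
-- denominator is P k (1 + q^{2k+2m+1}) = (1 + q^{2k+1}) P (k+1), and multiplying
-- G k - G (k+1) by it leaves q^{2km} (1 - q^{2m}). So the K-th partial sum is T 1 - T (K+1),
-- where T 1 is the right-hand side and T (K+1) is divisible by q^{2(K+1)m}; hence its
-- coefficient of q^n is that of the right-hand side once K ≥ n.

open import Defs
open import Data.Nat as ℕ using (ℕ; zero; suc; _∸_; _≤_; _<_; z≤n; s≤s)
import Data.Nat.Properties as ℕP
import Data.Nat.Tactic.RingSolver as ℕSolver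
open import Data.Integer using (ℤ; +_; -_; _+_; _*_; _-_)
import Data.Integer.Properties as ℤP
import Data.Integer.Tactic.RingSolver as ℤSolver
open import Data.List using (_∷_; map; upTo; applyUpTo; zipWith)
open import Data.List.Properties using (map-upTo)
open import Data.Product using (_,_)
open import Data.Sum using (inj₁; inj₂)
open import Function using (_∘_)
open import Relation.Binary.PropositionalEquality
open import Relation.Nullary using (Dec; yes; no; contradiction)
import Relation.Binary.Reasoning.Setoid as SetoidReasoning
open import Algebra.Bundles using (CommutativeRing)
open import Algebra.Structures using (IsCommutativeRing)
open import Algebra.Consequences.Setoid (ℕ →-setoid ℤ) using (comm∧idˡ⇒id; comm∧distrˡ⇒distr)
import Algebra.Construct.Pointwise ℕ as Pointwise
open import Algebra.Properties.CommutativeSemigroup ℤP.+-commutativeSemigroup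
  using () renaming (interchange to +-interchange)

Σ : ℕ → (ℕ → ℤ) → ℤ
Σ n f = sumℤ (applyUpTo f n)

Σ-cong : ∀ n {f g : ℕ → ℤ} → (∀ j → j < n → f j ≡ g j) → Σ n f ≡ Σ n g
Σ-cong zero    eq = refl
Σ-cong (suc n) eq = cong₂ _+_ (eq 0 (s≤s z≤n)) (Σ-cong n (λ j j<n → eq (suc j) (s≤s j<n)))

Σ-zero : ∀ n {f : ℕ → ℤ} → (∀ j → j < n → f j ≡ + 0) → Σ n f ≡ + 0
Σ-zero zero    eq = refl
Σ-zero (suc n) eq = cong₂ _+_ (eq 0 (s≤s z≤n)) (Σ-zero n (λ j j<n → eq (suc j) (s≤s j<n)))

Σ-last : ∀ n (f : ℕ → ℤ) → Σ (suc n) f ≡ Σ n f + f n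
Σ-last zero    f = trans (ℤP.+-identityʳ (f 0)) (sym (ℤP.+-identityˡ (f 0)))
Σ-last (suc n) f = trans (cong (λ s → f 0 + s) (Σ-last n (f ∘ suc))) (sym (ℤP.+-assoc (f 0) _ _))

Σ-distrib-+ : ∀ n (f g : ℕ → ℤ) → Σ n (λ j → f j + g j) ≡ Σ n f + Σ n g
Σ-distrib-+ zero    f g = refl
Σ-distrib-+ (suc n) f g =
  trans (cong (λ s → f 0 + g 0 + s) (Σ-distrib-+ n (f ∘ suc) (g ∘ suc)))
        (+-interchange (f 0) (g 0) _ _)

Σ-distribˡ-* : ∀ n c (f : ℕ → ℤ) → c * Σ n f ≡ Σ n (λ j → c * f j)
Σ-distribˡ-* zero    c f = ℤP.*-zeroʳ c
Σ-distribˡ-* (suc n) c f =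
  trans (ℤP.*-distribˡ-+ c (f 0) _) (cong (λ s → c * f 0 + s) (Σ-distribˡ-* n c (f ∘ suc)))

Σ-distribʳ-* : ∀ n c (f : ℕ → ℤ) → Σ n f * c ≡ Σ n (λ j → f j * c)
Σ-distribʳ-* n c f =
  trans (ℤP.*-comm _ c) (trans (Σ-distribˡ-* n c f) (Σ-cong n (λ j _ → ℤP.*-comm c (f j))))

Σ-reverse : ∀ n (f : ℕ → ℤ) → Σ (suc n) f ≡ Σ (suc n) (λ j → f (n ∸ j))
Σ-reverse zero    f = refl
Σ-reverse (suc n) f = begin
  f 0 + Σ (suc n) (f ∘ suc)
    ≡⟨ cong (λ s → f 0 + s) (Σ-reverse n (f ∘ suc)) ⟩
  f 0 + Σ (suc n) (λ j → f (suc (n ∸ j)))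
    ≡⟨ ℤP.+-comm (f 0) _ ⟩
  Σ (suc n) (λ j → f (suc (n ∸ j))) + f 0
    ≡⟨ cong₂ _+_ (Σ-cong (suc n) suc-∸) (cong f (sym (ℕP.n∸n≡0 n))) ⟩
  Σ (suc n) (λ j → f (suc n ∸ j)) + f (n ∸ n)
    ≡⟨ Σ-last (suc n) (λ j → f (suc n ∸ j)) ⟨
  Σ (suc (suc n)) (λ j → f (suc n ∸ j))
    ∎
  where
  open ≡-Reasoning
  suc-∸ : ∀ j → j < suc n → f (suc (n ∸ j)) ≡ f (suc n ∸ j)
  suc-∸ j j<1+n = cong f (sym (ℕP.+-∸-assoc 1 (ℕP.≤-pred j<1+n)))

-- Split off the i = 0 terms on both sides; the rest is the same identity for G shifted in both indices.
Σ-triangle : ∀ n (G : ℕ → ℕ → ℤ) →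
  Σ (suc n) (λ j → Σ (suc j) (λ i → G i j)) ≡
  Σ (suc n) (λ i → Σ (suc (n ∸ i)) (λ l → G i (i ℕ.+ l)))
Σ-triangle zero    G = refl
Σ-triangle (suc n) G = begin
  (G 0 0 + + 0) + Σ (suc n) (λ j → G 0 (suc j) + inner j)
    ≡⟨ cong (λ s → G 0 0 + + 0 + s) (Σ-distrib-+ (suc n) (G 0 ∘ suc) inner) ⟩
  (G 0 0 + + 0) + (Σ (suc n) (G 0 ∘ suc) + Σ (suc n) inner)
    ≡⟨ cong (λ s → G 0 0 + + 0 + (Σ (suc n) (G 0 ∘ suc) + s)) (Σ-triangle n G′) ⟩
  (G 0 0 + + 0) + (Σ (suc n) (G 0 ∘ suc) + Σ (suc n) outer)
    ≡⟨ regroup (G 0 0) (Σ (suc n) (G 0 ∘ suc)) (Σ (suc n) outer) ⟩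
  (G 0 0 + Σ (suc n) (G 0 ∘ suc)) + Σ (suc n) outer
    ∎
  where
  open ≡-Reasoning
  G′ : ℕ → ℕ → ℤ
  G′ i j = G (suc i) (suc j)
  inner : ℕ → ℤ
  inner j = Σ (suc j) (λ i → G′ i j)
  outer : ℕ → ℤ
  outer i = Σ (suc (n ∸ i)) (λ l → G′ i (i ℕ.+ l))
  regroup : ∀ a b c → (a + + 0) + (b + c) ≡ (a + b) + c
  regroup = ℤSolver.solve-∀

⊗-coeff : ∀ f g n → (f ⊗ g) n ≡ Σ (suc n) (λ j → f j * g (n ∸ j))
⊗-coeff f g n = cong sumℤ (map-upTo (λ j → f j * g (n ∸ j)) (suc n))

q^-diag : ∀ a → q^ a a ≡ + 1
q^-diag a with a ℕ.≟ a
... | yes _   = refl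
... | no  a≢a = contradiction refl a≢a

q^-off : ∀ {a n} → n ≢ a → q^ a n ≡ + 0
q^-off {a} {n} n≢a with n ℕ.≟ a
... | yes n≡a = contradiction n≡a n≢a
... | no  _   = refl

q^-cong : ∀ {a b} → a ≡ b → q^ a ≈ₛ q^ b
q^-cong refl _ = refl

q^-+-cancelˡ : ∀ a b k → q^ (a ℕ.+ b) (a ℕ.+ k) ≡ q^ b k
q^-+-cancelˡ a b k = by-cases (k ℕ.≟ b)
  where
  by-cases : Dec (k ≡ b) → q^ (a ℕ.+ b) (a ℕ.+ k) ≡ q^ b k
  by-cases (yes refl) = trans (q^-diag (a ℕ.+ b)) (sym (q^-diag b))
  by-cases (no  k≢b)  = trans (q^-off (k≢b ∘ ℕP.+-cancelˡ-≡ a k b)) (sym (q^-off k≢b))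

Σ-q^-none : ∀ n a (h : ℕ → ℤ) → n ≤ a → Σ n (λ j → q^ a j * h j) ≡ + 0
Σ-q^-none n a h n≤a = Σ-zero n (λ j j<n →
  cong (_* h j) (q^-off (λ j≡a → ℕP.<-irrefl j≡a (ℕP.<-≤-trans j<n n≤a))))

Σ-q^-select : ∀ n a (h : ℕ → ℤ) → a < n → Σ n (λ j → q^ a j * h j) ≡ h a
Σ-q^-select (suc n) a h a<1+n with ℕP.m≤n⇒m<n∨m≡n (ℕP.≤-pred a<1+n)
... | inj₁ a<n = begin
  Σ (suc n) (λ j → q^ a j * h j)
    ≡⟨ Σ-last n (λ j → q^ a j * h j) ⟩
  Σ n (λ j → q^ a j * h j) + q^ a n * h n
    ≡⟨ cong₂ _+_ (Σ-q^-select n a h a<n) (cong (_* h n) (q^-off (ℕP.<⇒≢ a<n ∘ sym))) ⟩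
  h a + + 0 * h n
    ≡⟨ ℤP.+-identityʳ (h a) ⟩
  h a
    ∎
  where open ≡-Reasoning
... | inj₂ refl = begin
  Σ (suc n) (λ j → q^ n j * h j)
    ≡⟨ Σ-last n (λ j → q^ n j * h j) ⟩
  Σ n (λ j → q^ n j * h j) + q^ n n * h n
    ≡⟨ cong₂ _+_ (Σ-q^-none n n h ℕP.≤-refl) (cong (_* h n) (q^-diag n)) ⟩
  + 0 + + 1 * h n
    ≡⟨ trans (ℤP.+-identityˡ _) (ℤP.*-identityˡ (h n)) ⟩
  h n
    ∎
  where open ≡-Reasoning

q^-⊗-shift : ∀ a f n → (q^ a ⊗ f) (a ℕ.+ n) ≡ f n
q^-⊗-shift a f n = begin
  (q^ a ⊗ f) (a ℕ.+ n)
    ≡⟨ ⊗-coeff (q^ a) f (a ℕ.+ n) ⟩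
  Σ (suc (a ℕ.+ n)) (λ j → q^ a j * f (a ℕ.+ n ∸ j))
    ≡⟨ Σ-q^-select (suc (a ℕ.+ n)) a (λ j → f (a ℕ.+ n ∸ j)) (s≤s (ℕP.m≤m+n a n)) ⟩
  f (a ℕ.+ n ∸ a)
    ≡⟨ cong f (ℕP.m+n∸m≡n a n) ⟩
  f n
    ∎
  where open ≡-Reasoning

q^-⊗-low : ∀ a f {n} → n < a → (q^ a ⊗ f) n ≡ + 0
q^-⊗-low a f {n} n<a = trans (⊗-coeff (q^ a) f n) (Σ-q^-none (suc n) a (λ j → f (n ∸ j)) n<a)

q^-+ : ∀ a b → q^ (a ℕ.+ b) ≈ₛ (q^ a ⊗ q^ b)
q^-+ a b n with n ℕ.<? a
... | yes n<a = trans (q^-off n≢a+b) (sym (q^-⊗-low a (q^ b) n<a))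
  where
  n≢a+b : n ≢ a ℕ.+ b
  n≢a+b n≡a+b = ℕP.<⇒≱ n<a (ℕP.≤-trans (ℕP.m≤m+n a b) (ℕP.≤-reflexive (sym n≡a+b)))
... | no  n≮a with ℕP.m≤n⇒∃[o]m+o≡n (ℕP.≮⇒≥ n≮a)
...   | k , refl = trans (q^-+-cancelˡ a b k) (sym (q^-⊗-shift a (q^ b) k))

𝟙≈q^0 : 𝟙 ≈ₛ q^ 0
𝟙≈q^0 zero    = sym (q^-diag 0)
𝟙≈q^0 (suc n) = sym (q^-off (ℕP.1+n≢0 {n}))

-- Formal power series form a commutative ring

𝟘 : FPS
𝟘 _ = + 0

⊝_ : FPS → FPS
(⊝ f) n = - f n

⊗-cong : ∀ {f f′ g g′} → f ≈ₛ f′ → g ≈ₛ g′ → (f ⊗ g) ≈ₛ (f′ ⊗ g′)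
⊗-cong {f} {f′} {g} {g′} f≈f′ g≈g′ n = begin
  (f ⊗ g) n
    ≡⟨ ⊗-coeff f g n ⟩
  Σ (suc n) (λ j → f j * g (n ∸ j))
    ≡⟨ Σ-cong (suc n) (λ j _ → cong₂ _*_ (f≈f′ j) (g≈g′ (n ∸ j))) ⟩
  Σ (suc n) (λ j → f′ j * g′ (n ∸ j))
    ≡⟨ ⊗-coeff f′ g′ n ⟨
  (f′ ⊗ g′) n
    ∎
  where open ≡-Reasoning

⊗-comm : ∀ f g → (f ⊗ g) ≈ₛ (g ⊗ f)
⊗-comm f g n = begin
  (f ⊗ g) n                                           ≡⟨ ⊗-coeff f g n ⟩
  Σ (suc n) (λ j → f j * g (n ∸ j))                   ≡⟨ Σ-reverse n (λ j → f j * g (n ∸ j)) ⟩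
  Σ (suc n) (λ j → f (n ∸ j) * g (n ∸ (n ∸ j)))       ≡⟨ Σ-cong (suc n) swap ⟩
  Σ (suc n) (λ j → g j * f (n ∸ j))                   ≡⟨ ⊗-coeff g f n ⟨
  (g ⊗ f) n                                           ∎
  where
  open ≡-Reasoning
  swap : ∀ j → j < suc n → f (n ∸ j) * g (n ∸ (n ∸ j)) ≡ g j * f (n ∸ j)
  swap j j<1+n = trans (cong (λ i → f (n ∸ j) * g i) (ℕP.m∸[m∸n]≡n (ℕP.≤-pred j<1+n)))
                       (ℤP.*-comm (f (n ∸ j)) (g j))

⊗-assoc : ∀ f g h → ((f ⊗ g) ⊗ h) ≈ₛ (f ⊗ (g ⊗ h))
⊗-assoc f g h n = begin
  ((f ⊗ g) ⊗ h) n
    ≡⟨ ⊗-coeff (f ⊗ g) h n ⟩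
  Σ (suc n) (λ j → (f ⊗ g) j * h (n ∸ j))
    ≡⟨ Σ-cong (suc n) (λ j _ → trans (cong (_* h (n ∸ j)) (⊗-coeff f g j))
                                     (Σ-distribʳ-* (suc j) (h (n ∸ j)) (λ i → f i * g (j ∸ i)))) ⟩
  Σ (suc n) (λ j → Σ (suc j) (λ i → f i * g (j ∸ i) * h (n ∸ j)))
    ≡⟨ Σ-triangle n (λ i j → f i * g (j ∸ i) * h (n ∸ j)) ⟩
  Σ (suc n) (λ i → Σ (suc (n ∸ i)) (λ l → f i * g (i ℕ.+ l ∸ i) * h (n ∸ (i ℕ.+ l))))
    ≡⟨ Σ-cong (suc n) (λ i _ → Σ-cong (suc (n ∸ i)) (λ l _ → reindex i l)) ⟩
  Σ (suc n) (λ i → Σ (suc (n ∸ i)) (λ l → f i * (g l * h (n ∸ i ∸ l))))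
    ≡⟨ Σ-cong (suc n) (λ i _ → trans (sym (Σ-distribˡ-* (suc (n ∸ i)) (f i) (λ l → g l * h (n ∸ i ∸ l))))
                                     (cong (f i *_) (sym (⊗-coeff g h (n ∸ i))))) ⟩
  Σ (suc n) (λ i → f i * (g ⊗ h) (n ∸ i))
    ≡⟨ ⊗-coeff f (g ⊗ h) n ⟨
  (f ⊗ (g ⊗ h)) n
    ∎
  where
  open ≡-Reasoning
  reindex : ∀ i l → f i * g (i ℕ.+ l ∸ i) * h (n ∸ (i ℕ.+ l)) ≡ f i * (g l * h (n ∸ i ∸ l))
  reindex i l = trans (cong₂ (λ a b → f i * g a * h b) (ℕP.m+n∸m≡n i l) (sym (ℕP.∸-+-assoc n i l)))
                      (ℤP.*-assoc (f i) (g l) (h (n ∸ i ∸ l)))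

⊗-identityˡ : ∀ f → (𝟙 ⊗ f) ≈ₛ f
⊗-identityˡ f n = trans (⊗-cong {g = f} 𝟙≈q^0 (λ _ → refl) n) (q^-⊗-shift 0 f n)

⊗-distribˡ-⊕ : ∀ f g h → (f ⊗ (g ⊕ h)) ≈ₛ ((f ⊗ g) ⊕ (f ⊗ h))
⊗-distribˡ-⊕ f g h n = begin
  (f ⊗ (g ⊕ h)) n
    ≡⟨ ⊗-coeff f (g ⊕ h) n ⟩
  Σ (suc n) (λ j → f j * (g (n ∸ j) + h (n ∸ j)))
    ≡⟨ Σ-cong (suc n) (λ j _ → ℤP.*-distribˡ-+ (f j) (g (n ∸ j)) (h (n ∸ j))) ⟩
  Σ (suc n) (λ j → f j * g (n ∸ j) + f j * h (n ∸ j))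
    ≡⟨ Σ-distrib-+ (suc n) (λ j → f j * g (n ∸ j)) (λ j → f j * h (n ∸ j)) ⟩
  Σ (suc n) (λ j → f j * g (n ∸ j)) + Σ (suc n) (λ j → f j * h (n ∸ j))
    ≡⟨ cong₂ _+_ (⊗-coeff f g n) (⊗-coeff f h n) ⟨
  ((f ⊗ g) ⊕ (f ⊗ h)) n
    ∎
  where open ≡-Reasoning

⊕-⊗-isCommutativeRing : IsCommutativeRing _≈ₛ_ _⊕_ _⊗_ ⊝_ 𝟘 𝟙
⊕-⊗-isCommutativeRing = record
  { isRing = record
    { +-isAbelianGroup = Pointwise.isAbelianGroup ℤP.+-0-isAbelianGroup
    ; *-cong           = ⊗-cong
    ; *-assoc          = ⊗-assoc
    ; *-identity       = comm∧idˡ⇒id ⊗-comm ⊗-identityˡ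
    ; distrib          = comm∧distrˡ⇒distr (λ f≈f′ g≈g′ n → cong₂ _+_ (f≈f′ n) (g≈g′ n))
                                           ⊗-comm ⊗-distribˡ-⊕
    }
  ; *-comm = ⊗-comm
  }

FPS-commutativeRing : CommutativeRing _ _
FPS-commutativeRing = record { isCommutativeRing = ⊕-⊗-isCommutativeRing }

open CommutativeRing FPS-commutativeRing
  using (*-commutativeMonoid)
  renaming ( setoid to FPS-setoid; sym to ≈-sym; trans to ≈-trans
           ; +-cong to ⊕-cong; *-congˡ to ⊗-congˡ; *-congʳ to ⊗-congʳ; *-identityʳ to ⊗-identityʳ )
open import Algebra.Solver.CommutativeMonoid *-commutativeMonoid using (solve; _⊜_) renaming (_⊕_ to _⊛_)
open import Algebra.Properties.Ring (CommutativeRing.ring FPS-commutativeRing)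
  using () renaming (x[y-z]≈xy-xz to ⊗-distribˡ-⊖; [y-z]x≈yx-zx to ⊗-distribʳ-⊖)
module ≈-Reasoning = SetoidReasoning FPS-setoid

⊖-cong : ∀ {f f′ g g′} → f ≈ₛ f′ → g ≈ₛ g′ → (f ⊖ g) ≈ₛ (f′ ⊖ g′)
⊖-cong f≈f′ g≈g′ n = cong₂ _-_ (f≈f′ n) (g≈g′ n)

⊕-⊖-cancelʳ : ∀ f g h → ((f ⊕ h) ⊖ (g ⊕ h)) ≈ₛ (f ⊖ g)
⊕-⊖-cancelʳ f g h n = cancel (f n) (g n) (h n)
  where
  cancel : ∀ a b c → (a + c) - (b + c) ≡ a - b
  cancel = ℤSolver.solve-∀

q^⊗[𝟙⊕q^] : ∀ a b → (q^ a ⊗ (𝟙 ⊕ q^ b)) ≈ₛ (q^ a ⊕ q^ (a ℕ.+ b))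
q^⊗[𝟙⊕q^] a b n = trans (⊗-distribˡ-⊕ (q^ a) 𝟙 (q^ b) n)
                        (cong₂ _+_ (⊗-identityʳ (q^ a) n) (sym (q^-+ a b n)))

q^⊗[𝟙⊖q^] : ∀ a b → (q^ a ⊗ (𝟙 ⊖ q^ b)) ≈ₛ (q^ a ⊖ q^ (a ℕ.+ b))
q^⊗[𝟙⊖q^] a b n = trans (⊗-distribˡ-⊖ (q^ a) 𝟙 (q^ b) n)
                        (cong₂ _-_ (⊗-identityʳ (q^ a) n) (sym (q^-+ a b n)))

⊕-⊖-telescope : ∀ f g h → ((f ⊖ g) ⊕ (g ⊖ h)) ≈ₛ (f ⊖ h)
⊕-⊖-telescope f g h n = telescope (f n) (g n) (h n)
  where
  telescope : ∀ a b c → (a - b) + (b - c) ≡ a - c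
  telescope = ℤSolver.solve-∀

-- Inverses of series with constant term 1

ConstTermOne : FPS → Set
ConstTermOne f = f 0 ≡ + 1

zipWith-applyUpTo : ∀ {A B C : Set} (_∙_ : A → B → C) (g : ℕ → A) (h : ℕ → B) n →
  zipWith _∙_ (applyUpTo g n) (applyUpTo h n) ≡ applyUpTo (λ j → g j ∙ h j) n
zipWith-applyUpTo _∙_ g h zero    = refl
zipWith-applyUpTo _∙_ g h (suc n) = cong (g 0 ∙ h 0 ∷_) (zipWith-applyUpTo _∙_ (g ∘ suc) (h ∘ suc) n)

invList≡applyUpTo : ∀ f n → invList f n ≡ applyUpTo (λ j → inv f (n ∸ j)) (suc n)
invList≡applyUpTo f zero    = refl
invList≡applyUpTo f (suc n) = cong (inv f (suc n) ∷_) (invList≡applyUpTo f n)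

inv-suc : ∀ f n → inv f (suc n) ≡ - Σ (suc n) (λ j → f (suc j) * inv f (n ∸ j))
inv-suc f n = cong (-_ ∘ sumℤ) (begin
  zipWith _*_ (map (f ∘ suc) (upTo (suc n))) (invList f n)
    ≡⟨ cong₂ (zipWith _*_) (map-upTo (f ∘ suc) (suc n)) (invList≡applyUpTo f n) ⟩
  zipWith _*_ (applyUpTo (f ∘ suc) (suc n)) (applyUpTo (λ j → inv f (n ∸ j)) (suc n))
    ≡⟨ zipWith-applyUpTo _*_ (f ∘ suc) (λ j → inv f (n ∸ j)) (suc n) ⟩
  applyUpTo (λ j → f (suc j) * inv f (n ∸ j)) (suc n)
    ∎)
  where open ≡-Reasoning

⊗-inverseʳ : ∀ f → ConstTermOne f → (f ⊗ inv f) ≈ₛ 𝟙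
⊗-inverseʳ f f₀≡1 zero    = trans (⊗-coeff f (inv f) 0) (cong (λ c → c * + 1 + + 0) f₀≡1)
⊗-inverseʳ f f₀≡1 (suc n) = begin
  (f ⊗ inv f) (suc n)             ≡⟨ ⊗-coeff f (inv f) (suc n) ⟩
  f 0 * inv f (suc n) + s         ≡⟨ cong₂ (λ c i → c * i + s) f₀≡1 (inv-suc f n) ⟩
  + 1 * - s + s                   ≡⟨ cancel s ⟩
  + 0                             ∎
  where
  open ≡-Reasoning
  s = Σ (suc n) (λ j → f (suc j) * inv f (n ∸ j))
  cancel : ∀ s → + 1 * - s + s ≡ + 0
  cancel = ℤSolver.solve-∀

f⊗d≈g⇒f≈g⊘d : ∀ {f g} d → ConstTermOne d → (f ⊗ d) ≈ₛ g → f ≈ₛ (g ⊘ d)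
f⊗d≈g⇒f≈g⊘d {f} {g} d d₀≡1 f⊗d≈g = begin
  f                    ≈⟨ ⊗-identityʳ f ⟨
  f ⊗ 𝟙                ≈⟨ ⊗-congˡ {f} (⊗-inverseʳ d d₀≡1) ⟨
  f ⊗ (d ⊗ inv d)      ≈⟨ ⊗-assoc f d (inv d) ⟨
  (f ⊗ d) ⊗ inv d      ≈⟨ ⊗-congʳ {inv d} f⊗d≈g ⟩
  g ⊗ inv d            ∎
  where open ≈-Reasoning

[g⊘d]⊗d≈g : ∀ {d} g → ConstTermOne d → ((g ⊘ d) ⊗ d) ≈ₛ g
[g⊘d]⊗d≈g {d} g d₀≡1 = begin
  (g ⊗ inv d) ⊗ d      ≈⟨ rearrange g (inv d) d ⟩
  g ⊗ (d ⊗ inv d)      ≈⟨ ⊗-congˡ {g} (⊗-inverseʳ d d₀≡1) ⟩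
  g ⊗ 𝟙                ≈⟨ ⊗-identityʳ g ⟩
  g                    ∎
  where
  open ≈-Reasoning
  rearrange : ∀ g i d → ((g ⊗ i) ⊗ d) ≈ₛ (g ⊗ (d ⊗ i))
  rearrange = solve 3 (λ g i d → (g ⊛ i) ⊛ d ⊜ g ⊛ (d ⊛ i)) (λ _ → refl)

inv-cong : ∀ {d d′} → ConstTermOne d → d ≈ₛ d′ → inv d ≈ₛ inv d′
inv-cong {d} {d′} d₀≡1 d≈d′ = begin
  inv d         ≈⟨ f⊗d≈g⇒f≈g⊘d d′ (trans (sym (d≈d′ 0)) d₀≡1) inv[d]⊗d′≈𝟙 ⟩
  𝟙 ⊗ inv d′    ≈⟨ ⊗-identityˡ (inv d′) ⟩
  inv d′        ∎
  where
  open ≈-Reasoning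
  inv[d]⊗d′≈𝟙 : (inv d ⊗ d′) ≈ₛ 𝟙
  inv[d]⊗d′≈𝟙 = begin
    inv d ⊗ d′    ≈⟨ ⊗-comm (inv d) d′ ⟩
    d′ ⊗ inv d    ≈⟨ ⊗-congʳ {inv d} d≈d′ ⟨
    d ⊗ inv d     ≈⟨ ⊗-inverseʳ d d₀≡1 ⟩
    𝟙             ∎

⊗-ConstTermOne : ∀ f g → ConstTermOne f → ConstTermOne g → ConstTermOne (f ⊗ g)
⊗-ConstTermOne f g f₀≡1 g₀≡1 = cong₂ (λ a b → a * b + + 0) f₀≡1 g₀≡1

𝟙⊕q^-ConstTermOne : ∀ {a} → a ≢ 0 → ConstTermOne (𝟙 ⊕ q^ a)
𝟙⊕q^-ConstTermOne a≢0 = cong (λ c → + 1 + c) (q^-off (a≢0 ∘ sym))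

𝟙⊖q^-ConstTermOne : ∀ {a} → a ≢ 0 → ConstTermOne (𝟙 ⊖ q^ a)
𝟙⊖q^-ConstTermOne a≢0 = cong (λ c → + 1 - c) (q^-off (a≢0 ∘ sym))

Σ<-telescope : ∀ K {F H : ℕ → FPS} → (∀ k → F k ≈ₛ (H k ⊖ H (suc k))) → Σ< K F ≈ₛ (H 0 ⊖ H K)
Σ<-telescope zero    {H = H} _     n = sym (ℤP.+-inverseʳ (H 0 n))
Σ<-telescope (suc K) {F} {H} F≈ΔH n = begin
  (Σ< K F ⊕ F K) n                       ≡⟨ cong₂ _+_ (Σ<-telescope K {H = H} F≈ΔH n) (F≈ΔH K n) ⟩
  ((H 0 ⊖ H K) ⊕ (H K ⊖ H (suc K))) n    ≡⟨ ⊕-⊖-telescope (H 0) (H K) (H (suc K)) n ⟩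
  (H 0 ⊖ H (suc K)) n                    ∎
  where open ≡-Reasoning

Π<-cong : ∀ m {F G : ℕ → FPS} → (∀ i → F i ≈ₛ G i) → Π< m F ≈ₛ Π< m G
Π<-cong zero    F≈G _ = refl
Π<-cong (suc m) F≈G   = ⊗-cong (Π<-cong m F≈G) (F≈G m)

Π<-ConstTermOne : ∀ m (F : ℕ → FPS) → (∀ i → ConstTermOne (F i)) → ConstTermOne (Π< m F)
Π<-ConstTermOne zero    F _    = refl
Π<-ConstTermOne (suc m) F F₀≡1 = ⊗-ConstTermOne (Π< m F) (F m) (Π<-ConstTermOne m F F₀≡1) (F₀≡1 m)

Π<-first : ∀ m (F : ℕ → FPS) → Π< (suc m) F ≈ₛ (F 0 ⊗ Π< m (F ∘ suc))
Π<-first zero    F = ⊗-comm 𝟙 (F 0)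
Π<-first (suc m) F = begin
  Π< (suc m) F ⊗ F (suc m)                   ≈⟨ ⊗-congʳ {F (suc m)} (Π<-first m F) ⟩
  (F 0 ⊗ Π< m (F ∘ suc)) ⊗ F (suc m)         ≈⟨ ⊗-assoc (F 0) (Π< m (F ∘ suc)) (F (suc m)) ⟩
  F 0 ⊗ Π< (suc m) (F ∘ suc)                 ∎
  where open ≈-Reasoning

Π<-q^-+ : ∀ m x (y : ℕ → ℕ) → Π< m (λ i → q^ (x ℕ.+ y i)) ≈ₛ (q^ (m ℕ.* x) ⊗ Π< m (q^ ∘ y))
Π<-q^-+ zero    x y = ≈-trans 𝟙≈q^0 (≈-sym (⊗-identityʳ (q^ 0)))
Π<-q^-+ (suc m) x y = begin
  Π< m (λ i → q^ (x ℕ.+ y i)) ⊗ q^ (x ℕ.+ y m)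
    ≈⟨ ⊗-cong (Π<-q^-+ m x y) (q^-+ x (y m)) ⟩
  (q^ (m ℕ.* x) ⊗ Π< m (q^ ∘ y)) ⊗ (q^ x ⊗ q^ (y m))
    ≈⟨ interchange (q^ (m ℕ.* x)) (Π< m (q^ ∘ y)) (q^ x) (q^ (y m)) ⟩
  (q^ (m ℕ.* x) ⊗ q^ x) ⊗ Π< (suc m) (q^ ∘ y)
    ≈⟨ ⊗-congʳ {Π< (suc m) (q^ ∘ y)} (≈-sym (q^-+ (m ℕ.* x) x)) ⟩
  q^ (m ℕ.* x ℕ.+ x) ⊗ Π< (suc m) (q^ ∘ y)
    ≈⟨ ⊗-congʳ {Π< (suc m) (q^ ∘ y)} (q^-cong (ℕP.+-comm (m ℕ.* x) x)) ⟩
  q^ (suc m ℕ.* x) ⊗ Π< (suc m) (q^ ∘ y)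
    ∎
  where
  open ≈-Reasoning
  interchange : ∀ a b c d → ((a ⊗ b) ⊗ (c ⊗ d)) ≈ₛ ((a ⊗ c) ⊗ (b ⊗ d))
  interchange = solve 4 (λ a b c d → (a ⊛ b) ⊛ (c ⊛ d) ⊜ (a ⊛ c) ⊛ (b ⊛ d)) (λ _ → refl)

-- The summands telescope

module _ (m : ℕ) where

  P : ℕ → FPS
  P k = Π< m (λ i → 𝟙 ⊕ q^ (2 ℕ.* k ℕ.+ 2 ℕ.* i ℕ.+ 1))

  D : ℕ → FPS
  D k = Π< (suc m) (λ i → 𝟙 ⊕ q^ (2 ℕ.* k ℕ.+ 2 ℕ.* i ℕ.+ 1))

  c : FPS
  c = Π< m (λ i → q^ (2 ℕ.* suc i))

  E : FPS
  E = 𝟙 ⊖ q^ (2 ℕ.* m)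

  G : ℕ → FPS
  G k = q^ (2 ℕ.* k ℕ.* m) ⊘ P k

  T : ℕ → FPS
  T k = (c ⊗ G k) ⊘ E

  P-ConstTermOne : ∀ k → ConstTermOne (P k)
  P-ConstTermOne k =
    Π<-ConstTermOne m _ (λ i → 𝟙⊕q^-ConstTermOne (ℕP.m+1+n≢0 (2 ℕ.* k ℕ.+ 2 ℕ.* i)))

  D-ConstTermOne : ∀ k → ConstTermOne (D k)
  D-ConstTermOne k =
    Π<-ConstTermOne (suc m) _ (λ i → 𝟙⊕q^-ConstTermOne (ℕP.m+1+n≢0 (2 ℕ.* k ℕ.+ 2 ℕ.* i)))

  E-ConstTermOne : 1 ≤ m → ConstTermOne E
  E-ConstTermOne 1≤m =
    𝟙⊖q^-ConstTermOne (ℕP.m<n⇒n≢0 (ℕP.<-≤-trans (s≤s z≤n) (ℕP.*-monoʳ-≤ 2 1≤m)))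

  D≈first⊗P : ∀ k → D k ≈ₛ ((𝟙 ⊕ q^ (2 ℕ.* k ℕ.+ 2 ℕ.* 0 ℕ.+ 1)) ⊗ P (suc k))
  D≈first⊗P k = ≈-trans (Π<-first m _) (⊗-congˡ {𝟙 ⊕ q^ (2 ℕ.* k ℕ.+ 2 ℕ.* 0 ℕ.+ 1)}
    (Π<-cong m (λ i n → cong (λ e → 𝟙 n + q^ e n) (shift k i))))
    where
    shift : ∀ k i → 2 ℕ.* k ℕ.+ 2 ℕ.* suc i ℕ.+ 1 ≡ 2 ℕ.* suc k ℕ.+ 2 ℕ.* i ℕ.+ 1
    shift = ℕSolver.solve-∀

  -- Both products collapse to two monomials, and the top-degree ones coincide.
  G-difference : ∀ k → ((G k ⊖ G (suc k)) ⊗ D k) ≈ₛ (q^ (2 ℕ.* k ℕ.* m) ⊗ E)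
  G-difference k = begin
    (G k ⊖ G (suc k)) ⊗ D k
      ≈⟨ ⊗-distribʳ-⊖ (D k) (G k) (G (suc k)) ⟩
    (G k ⊗ D k) ⊖ (G (suc k) ⊗ D k)
      ≈⟨ ⊖-cong G⊗D G′⊗D ⟩
    (q^ a ⊕ q^ (a ℕ.+ b)) ⊖ (q^ (a ℕ.+ 2m) ⊕ q^ (a ℕ.+ b))
      ≈⟨ ⊕-⊖-cancelʳ (q^ a) (q^ (a ℕ.+ 2m)) (q^ (a ℕ.+ b)) ⟩
    q^ a ⊖ q^ (a ℕ.+ 2m)
      ≈⟨ q^⊗[𝟙⊖q^] a 2m ⟨
    q^ a ⊗ E
      ∎
    where
    open ≈-Reasoning
    a 2m b b₀ : ℕ
    a  = 2 ℕ.* k ℕ.* m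
    2m = 2 ℕ.* m
    b  = 2 ℕ.* k ℕ.+ 2 ℕ.* m ℕ.+ 1
    b₀ = 2 ℕ.* k ℕ.+ 2 ℕ.* 0 ℕ.+ 1
    exponent₁ : ∀ k m → 2 ℕ.* suc k ℕ.* m ≡ 2 ℕ.* k ℕ.* m ℕ.+ 2 ℕ.* m
    exponent₁ = ℕSolver.solve-∀
    exponent₂ : ∀ k m → 2 ℕ.* suc k ℕ.* m ℕ.+ (2 ℕ.* k ℕ.+ 2 ℕ.* 0 ℕ.+ 1)
                      ≡ 2 ℕ.* k ℕ.* m ℕ.+ (2 ℕ.* k ℕ.+ 2 ℕ.* m ℕ.+ 1)
    exponent₂ = ℕSolver.solve-∀
    G⊗D : (G k ⊗ D k) ≈ₛ (q^ a ⊕ q^ (a ℕ.+ b))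
    G⊗D = begin
      G k ⊗ (P k ⊗ (𝟙 ⊕ q^ b))
        ≈⟨ ⊗-assoc (G k) (P k) (𝟙 ⊕ q^ b) ⟨
      (G k ⊗ P k) ⊗ (𝟙 ⊕ q^ b)
        ≈⟨ ⊗-congʳ {𝟙 ⊕ q^ b} ([g⊘d]⊗d≈g (q^ a) (P-ConstTermOne k)) ⟩
      q^ a ⊗ (𝟙 ⊕ q^ b)
        ≈⟨ q^⊗[𝟙⊕q^] a b ⟩
      q^ a ⊕ q^ (a ℕ.+ b)
        ∎
    G′⊗D : (G (suc k) ⊗ D k) ≈ₛ (q^ (a ℕ.+ 2m) ⊕ q^ (a ℕ.+ b))
    G′⊗D = begin
      G (suc k) ⊗ D k
        ≈⟨ ⊗-congˡ {G (suc k)} (≈-trans (D≈first⊗P k) (⊗-comm (𝟙 ⊕ q^ b₀) (P (suc k)))) ⟩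
      G (suc k) ⊗ (P (suc k) ⊗ (𝟙 ⊕ q^ b₀))
        ≈⟨ ⊗-assoc (G (suc k)) (P (suc k)) (𝟙 ⊕ q^ b₀) ⟨
      (G (suc k) ⊗ P (suc k)) ⊗ (𝟙 ⊕ q^ b₀)
        ≈⟨ ⊗-congʳ {𝟙 ⊕ q^ b₀} ([g⊘d]⊗d≈g (q^ (2 ℕ.* suc k ℕ.* m)) (P-ConstTermOne (suc k))) ⟩
      q^ (2 ℕ.* suc k ℕ.* m) ⊗ (𝟙 ⊕ q^ b₀)
        ≈⟨ q^⊗[𝟙⊕q^] (2 ℕ.* suc k ℕ.* m) b₀ ⟩
      q^ (2 ℕ.* suc k ℕ.* m) ⊕ q^ (2 ℕ.* suc k ℕ.* m ℕ.+ b₀)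
        ≈⟨ ⊕-cong (q^-cong (exponent₁ k m)) (q^-cong (exponent₂ k m)) ⟩
      q^ (a ℕ.+ 2m) ⊕ q^ (a ℕ.+ b)
        ∎

  term≈q^⊗c⊘D : ∀ k → term m k ≈ₛ ((q^ (2 ℕ.* k ℕ.* m) ⊗ c) ⊘ D k)
  term≈q^⊗c⊘D k = ⊗-congʳ {inv (D k)} (≈-trans (Π<-q^-+ m (2 ℕ.* k) (λ i → 2 ℕ.* suc i))
                                               (⊗-congʳ {c} (q^-cong (exponent k m))))
    where
    exponent : ∀ k m → m ℕ.* (2 ℕ.* k) ≡ 2 ℕ.* k ℕ.* m
    exponent = ℕSolver.solve-∀

  term≈ΔT : 1 ≤ m → ∀ k → term m k ≈ₛ (T k ⊖ T (suc k))
  term≈ΔT 1≤m k = ≈-sym (begin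
    T k ⊖ T (suc k)
      ≈⟨ ⊗-distribʳ-⊖ (inv E) (c ⊗ G k) (c ⊗ G (suc k)) ⟨
    ((c ⊗ G k) ⊖ (c ⊗ G (suc k))) ⊗ inv E
      ≈⟨ ⊗-congʳ {inv E} (⊗-distribˡ-⊖ c (G k) (G (suc k))) ⟨
    (c ⊗ (G k ⊖ G (suc k))) ⊗ inv E
      ≈⟨ ⊗-congʳ {inv E} (⊗-congˡ {c} (f⊗d≈g⇒f≈g⊘d (D k) (D-ConstTermOne k) (G-difference k))) ⟩
    (c ⊗ ((q^ a ⊗ E) ⊗ inv (D k))) ⊗ inv E
      ≈⟨ rearrange c (q^ a) E (inv (D k)) (inv E) ⟩
    ((q^ a ⊗ c) ⊗ inv (D k)) ⊗ (E ⊗ inv E)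
      ≈⟨ ⊗-congˡ {(q^ a ⊗ c) ⊗ inv (D k)} (⊗-inverseʳ E (E-ConstTermOne 1≤m)) ⟩
    ((q^ a ⊗ c) ⊗ inv (D k)) ⊗ 𝟙
      ≈⟨ ⊗-identityʳ ((q^ a ⊗ c) ⊗ inv (D k)) ⟩
    (q^ a ⊗ c) ⊗ inv (D k)
      ≈⟨ term≈q^⊗c⊘D k ⟨
    term m k
      ∎)
    where
    open ≈-Reasoning
    a : ℕ
    a = 2 ℕ.* k ℕ.* m
    rearrange : ∀ c x e d e⁻¹ → ((c ⊗ ((x ⊗ e) ⊗ d)) ⊗ e⁻¹) ≈ₛ (((x ⊗ c) ⊗ d) ⊗ (e ⊗ e⁻¹))
    rearrange = solve 5 (λ c x e d e⁻¹ → (c ⊛ ((x ⊛ e) ⊛ d)) ⊛ e⁻¹ ⊜ ((x ⊛ c) ⊛ d) ⊛ (e ⊛ e⁻¹))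
                        (λ _ → refl)

  rhs≈T₁ : rhs m ≈ₛ T 1
  rhs≈T₁ = begin
    (q^ (2 ℕ.* m) ⊗ inv E) ⊗ (c ⊗ inv P′)
      ≈⟨ ⊗-congˡ {q^ (2 ℕ.* m) ⊗ inv E} (⊗-congˡ {c} (inv-cong P′-ConstTermOne P′≈P₁)) ⟩
    (q^ (2 ℕ.* m) ⊗ inv E) ⊗ (c ⊗ inv (P 1))
      ≈⟨ rearrange (q^ (2 ℕ.* m)) (inv E) c (inv (P 1)) ⟩
    (c ⊗ (q^ (2 ℕ.* m) ⊗ inv (P 1))) ⊗ inv E
      ∎
    where
    open ≈-Reasoning
    P′ : FPS
    P′ = Π< m (λ i → 𝟙 ⊕ q^ (2 ℕ.* suc i ℕ.+ 1))
    P′-ConstTermOne : ConstTermOne P′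
    P′-ConstTermOne = Π<-ConstTermOne m _ (λ i → 𝟙⊕q^-ConstTermOne (ℕP.m+1+n≢0 (2 ℕ.* suc i) {0}))
    exponent : ∀ i → 2 ℕ.* suc i ℕ.+ 1 ≡ 2 ℕ.* 1 ℕ.+ 2 ℕ.* i ℕ.+ 1
    exponent = ℕSolver.solve-∀
    P′≈P₁ : P′ ≈ₛ P 1
    P′≈P₁ = Π<-cong m (λ i n → cong (λ e → 𝟙 n + q^ e n) (exponent i))
    rearrange : ∀ x e⁻¹ c p⁻¹ → ((x ⊗ e⁻¹) ⊗ (c ⊗ p⁻¹)) ≈ₛ ((c ⊗ (x ⊗ p⁻¹)) ⊗ e⁻¹)
    rearrange = solve 4 (λ x e⁻¹ c p⁻¹ → (x ⊛ e⁻¹) ⊛ (c ⊛ p⁻¹) ⊜ (c ⊛ (x ⊛ p⁻¹)) ⊛ e⁻¹)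
                        (λ _ → refl)

  T-vanishes : ∀ K {n} → n < 2 ℕ.* K ℕ.* m → T K n ≡ + 0
  T-vanishes K {n} n<a =
    trans (rearrange c (q^ a) (inv (P K)) (inv E) n) (q^-⊗-low a ((c ⊗ inv (P K)) ⊗ inv E) n<a)
    where
    a : ℕ
    a = 2 ℕ.* K ℕ.* m
    rearrange : ∀ c x p⁻¹ e⁻¹ → ((c ⊗ (x ⊗ p⁻¹)) ⊗ e⁻¹) ≈ₛ (x ⊗ ((c ⊗ p⁻¹) ⊗ e⁻¹))
    rearrange = solve 4 (λ c x p⁻¹ e⁻¹ → (c ⊛ (x ⊛ p⁻¹)) ⊛ e⁻¹ ⊜ x ⊛ ((c ⊛ p⁻¹) ⊛ e⁻¹))
                        (λ _ → refl)

lemma5p2 : (m : ℕ) → 1 ≤ m → HasSum₁ (term m) (rhs m)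
lemma5p2 m 1≤m n = n , λ K n≤K → begin
  Σ< K (λ i → term m (suc i)) n
    ≡⟨ Σ<-telescope K {H = T m ∘ suc} (λ k → term≈ΔT m 1≤m (suc k)) n ⟩
  T m 1 n - T m (suc K) n
    ≡⟨ cong₂ _-_ (sym (rhs≈T₁ m n)) (T-vanishes m (suc K) (n<2[1+K]m K n≤K)) ⟩
  rhs m n - + 0
    ≡⟨ ℤP.+-identityʳ (rhs m n) ⟩
  rhs m n
    ∎
  where
  open ≡-Reasoning
  n<2[1+K]m : ∀ K → n ≤ K → n < 2 ℕ.* suc K ℕ.* m
  n<2[1+K]m K n≤K = ℕP.<-≤-trans (s≤s n≤K)
    (ℕP.≤-trans (ℕP.m≤n*m (suc K) 2) (ℕP.m≤m*n (2 ℕ.* suc K) m {{ℕ.>-nonZero 1≤m}}))
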